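{- For each $n\in\mathbb{N}$, $H(n)$ is equal to the greatest $k \in \mathbb{N}$ such that there is an economical hypergraph $(V,\mathcal{H})$ with $|V| = k$ containing no partitions of size greater than $n$.
   Context: A hypergraph is a set $V$ with a family $\mathcal{H}$ of subsets of $V$; a vertex is isolated if it lies in no hyperedge. $(V,\mathcal{H})$ is economical if it has no isolated points but $(V,\mathcal{H}\setminus\{E\})$ has an isolated point for every $E\in\mathcal{H}$. $(V,\mathcal{H})$ contains a partition of size $m$ if there are $D\subseteq V$, $\mathcal{P}\subseteq\mathcal{H}$ with $|D|=m$ and every member of $D$ in exactly one member of $\mathcal{P}$. $H(n)$ is the greatest $k$ such that there is a hypergraph with $|V|=k$, no isolated vertices, and no partition of size greater than $n$. -}

module Defs where

open import Data.Nat using (ℕ; _<_; _≤_)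
open import Data.Bool using (Bool; true; false; _∧_; not)
open import Data.Bool.Properties using () renaming (_≟_ to _≟ᵇ_)
open import Data.Fin using (Fin)
open import Data.Fin.Subset using (Subset; _∈_; _∉_; ∣_∣)
open import Data.Vec.Properties using (≡-dec)
open import Data.Product using (Σ; ∃; _×_)
open import Relation.Nullary using (¬_)
open import Relation.Nullary.Decidable using (⌊_⌋)
open import Relation.Binary.PropositionalEquality using (_≡_)

Fam : ℕ → Set
Fam k = Subset k → Bool

_∈ᶠ_ : ∀ {k} → Subset k → Fam k → Set
E ∈ᶠ 𝓗 = 𝓗 E ≡ true

Isolated : ∀ {k} → Fam k → Fin k → Set
Isolated 𝓗 v = ∀ E → E ∈ᶠ 𝓗 → v ∉ E

NoIsolated : ∀ {k} → Fam k → Set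
NoIsolated {k} 𝓗 = ∀ (v : Fin k) → ¬ Isolated 𝓗 v

remove : ∀ {k} → Fam k → Subset k → Fam k
remove 𝓗 E F = 𝓗 F ∧ not ⌊ ≡-dec _≟ᵇ_ F E ⌋

Economical : ∀ {k} → Fam k → Set
Economical {k} 𝓗 =
  NoIsolated 𝓗 × (∀ E → E ∈ᶠ 𝓗 → ∃ λ (v : Fin k) → Isolated (remove 𝓗 E) v)

ContainsPartition : ∀ {k} → Fam k → ℕ → Set
ContainsPartition {k} 𝓗 m =
  Σ (Subset k) λ D → Σ (Fam k) λ 𝒫 →
    (∣ D ∣ ≡ m)
    × (∀ E → E ∈ᶠ 𝒫 → E ∈ᶠ 𝓗)
    × (∀ v → v ∈ D →
         Σ (Subset k) λ E → (E ∈ᶠ 𝒫) × (v ∈ E)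
           × (∀ E′ → E′ ∈ᶠ 𝒫 → v ∈ E′ → E′ ≡ E))

NoPartitionAbove : ∀ {k} → ℕ → Fam k → Set
NoPartitionAbove n 𝓗 = ∀ m → n < m → ¬ ContainsPartition 𝓗 m

IsGreatest : (ℕ → Set) → ℕ → Set
IsGreatest P k = P k × (∀ j → P j → j ≤ k)

HAdmissible : ℕ → ℕ → Set
HAdmissible n k = Σ (Fam k) λ 𝓗 → NoIsolated 𝓗 × NoPartitionAbove n 𝓗

IsH : ℕ → ℕ → Set
IsH n k = IsGreatest (HAdmissible n) k

EconAdmissible : ℕ → ℕ → Set
EconAdmissible n k = Σ (Fam k) λ 𝓗 → Economical 𝓗 × NoPartitionAbove n 𝓗

module Submission where

-- Deleting, one at a time, hyperedges whose removal isolates no vertex turns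
-- any hypergraph without isolated vertices into an economical subhypergraph on
-- the same vertex set, and a partition contained in a subhypergraph is also
-- contained in the original one. Hence a k-vertex hypergraph without isolated
-- vertices and without partitions of size > n exists iff an economical one
-- does, so both conditions define the same set of k and the same maximum.

open import Defs
open import Data.Nat using (ℕ; zero; suc; _+_; _≤_; _<_; z≤n; s≤s)
open import Data.Nat.Properties using (+-mono-≤; +-mono-<-≤; +-mono-≤-<; ≤-refl; ≤-trans)
open import Data.Product using (_×_; _,_; Σ; ∃; proj₁)
open import Data.Bool using (Bool; true; false)
open import Data.Bool.Properties using () renaming (_≟_ to _≟ᵇ_)
open import Data.Vec using ([]; _∷_)
open import Data.Vec.Properties using (≡-dec)
open import Data.Fin using (Fin)
open import Data.Fin.Subset using (Subset; inside; outside)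
open import Data.Fin.Subset.Properties using (anySubset?; _∈?_)
open import Data.Fin.Properties using (all?; ¬∀⟶∃¬)
open import Function using (_∘_)
open import Relation.Nullary using (¬_; Dec; yes; no; contradiction)
open import Relation.Nullary.Decidable using (decidable-stable; ¬?; _×-dec_)
open import Relation.Binary.PropositionalEquality using (_≡_; refl)

private
  variable
    k : ℕ

_⊆ᶠ_ : Fam k → Fam k → Set
𝒢 ⊆ᶠ 𝓗 = ∀ E → E ∈ᶠ 𝒢 → E ∈ᶠ 𝓗

⊆ᶠ-refl : (𝓗 : Fam k) → 𝓗 ⊆ᶠ 𝓗
⊆ᶠ-refl 𝓗 E E∈𝓗 = E∈𝓗

⊆ᶠ-trans : {𝓕 𝒢 𝓗 : Fam k} → 𝓕 ⊆ᶠ 𝒢 → 𝒢 ⊆ᶠ 𝓗 → 𝓕 ⊆ᶠ 𝓗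
⊆ᶠ-trans 𝓕⊆𝒢 𝒢⊆𝓗 E E∈𝓕 = 𝒢⊆𝓗 E (𝓕⊆𝒢 E E∈𝓕)

remove-⊆ᶠ : (𝓗 : Fam k) (E : Subset k) → remove 𝓗 E ⊆ᶠ 𝓗
remove-⊆ᶠ 𝓗 E F F∈𝓗∖E with 𝓗 F
... | true  = refl
... | false = F∈𝓗∖E

remove-self : (𝓗 : Fam k) (E : Subset k) → remove 𝓗 E E ≡ false
remove-self 𝓗 E with ≡-dec _≟ᵇ_ E E | 𝓗 E
... | yes _  | true  = refl
... | yes _  | false = refl
... | no E≢E | _     = contradiction refl E≢E

indicator : Bool → ℕ
indicator true  = 1
indicator false = 0

size : Fam k → ℕ
size {zero}  𝓗 = indicator (𝓗 [])
size {suc k} 𝓗 = size (λ E → 𝓗 (inside ∷ E)) + size (λ E → 𝓗 (outside ∷ E))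

indicator-mono : {a b : Bool} → (a ≡ true → b ≡ true) → indicator a ≤ indicator b
indicator-mono {false}         _   = z≤n
indicator-mono {true}  {true}  _   = ≤-refl
indicator-mono {true}  {false} a⇒b with a⇒b refl
... | ()

size-mono : (𝒢 𝓗 : Fam k) → 𝒢 ⊆ᶠ 𝓗 → size 𝒢 ≤ size 𝓗
size-mono {zero}  𝒢 𝓗 𝒢⊆𝓗 = indicator-mono (𝒢⊆𝓗 [])
size-mono {suc k} 𝒢 𝓗 𝒢⊆𝓗 =
  +-mono-≤ (size-mono _ _ (λ E → 𝒢⊆𝓗 (inside ∷ E)))
           (size-mono _ _ (λ E → 𝒢⊆𝓗 (outside ∷ E)))

size-mono-< : (𝒢 𝓗 : Fam k) → 𝒢 ⊆ᶠ 𝓗 →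
              (E : Subset k) → 𝒢 E ≡ false → E ∈ᶠ 𝓗 → size 𝒢 < size 𝓗
size-mono-< {zero} 𝒢 𝓗 _ [] E∉𝒢 E∈𝓗 rewrite E∉𝒢 | E∈𝓗 = ≤-refl
size-mono-< {suc k} 𝒢 𝓗 𝒢⊆𝓗 (true ∷ E) E∉𝒢 E∈𝓗 =
  +-mono-<-≤ (size-mono-< _ _ (λ F → 𝒢⊆𝓗 (inside ∷ F)) E E∉𝒢 E∈𝓗)
             (size-mono _ _ (λ F → 𝒢⊆𝓗 (outside ∷ F)))
size-mono-< {suc k} 𝒢 𝓗 𝒢⊆𝓗 (false ∷ E) E∉𝒢 E∈𝓗 =
  +-mono-≤-< (size-mono _ _ (λ F → 𝒢⊆𝓗 (inside ∷ F)))
             (size-mono-< _ _ (λ F → 𝒢⊆𝓗 (outside ∷ F)) E E∉𝒢 E∈𝓗)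

size-remove-< : (𝓗 : Fam k) (E : Subset k) → E ∈ᶠ 𝓗 → size (remove 𝓗 E) < size 𝓗
size-remove-< 𝓗 E = size-mono-< (remove 𝓗 E) 𝓗 (remove-⊆ᶠ 𝓗 E) E (remove-self 𝓗 E)

_∈ᶠ?_ : (E : Subset k) (𝓗 : Fam k) → Dec (E ∈ᶠ 𝓗)
E ∈ᶠ? 𝓗 = 𝓗 E ≟ᵇ true

Isolated? : (𝓗 : Fam k) (v : Fin k) → Dec (Isolated 𝓗 v)
Isolated? 𝓗 v with anySubset? (λ E → (E ∈ᶠ? 𝓗) ×-dec (v ∈? E))
... | yes (E , E∈𝓗 , v∈E) = no (λ isolated → isolated E E∈𝓗 v∈E)
... | no ¬covered         = yes (λ E E∈𝓗 v∈E → ¬covered (E , E∈𝓗 , v∈E))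

NoIsolated? : (𝓗 : Fam k) → Dec (NoIsolated 𝓗)
NoIsolated? 𝓗 = all? (λ v → ¬? (Isolated? 𝓗 v))

¬NoIsolated⇒∃Isolated : (𝓗 : Fam k) → ¬ NoIsolated 𝓗 → ∃ (Isolated 𝓗)
¬NoIsolated⇒∃Isolated {k} 𝓗 ¬noIsolated
  with ¬∀⟶∃¬ k (λ v → ¬ Isolated 𝓗 v) (λ v → ¬? (Isolated? 𝓗 v)) ¬noIsolated
... | v , ¬¬isolated = v , decidable-stable (Isolated? 𝓗 v) ¬¬isolated

-- c is fuel: each deletion strictly decreases size 𝓗 < c.
economical-⊆ᶠ-bounded : (c : ℕ) (𝓗 : Fam k) → size 𝓗 < c → NoIsolated 𝓗 →
                        Σ (Fam k) λ 𝒢 → Economical 𝒢 × 𝒢 ⊆ᶠ 𝓗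
economical-⊆ᶠ-bounded (suc c) 𝓗 (s≤s size≤c) noIsolated
  with anySubset? (λ E → (E ∈ᶠ? 𝓗) ×-dec NoIsolated? (remove 𝓗 E))
... | yes (E , E∈𝓗 , noIsolated∖E) =
  let 𝒢 , economical , 𝒢⊆𝓗∖E = economical-⊆ᶠ-bounded c (remove 𝓗 E)
                                  (≤-trans (size-remove-< 𝓗 E E∈𝓗) size≤c) noIsolated∖E
  in 𝒢 , economical , ⊆ᶠ-trans 𝒢⊆𝓗∖E (remove-⊆ᶠ 𝓗 E)
... | no ¬removable =
  𝓗 , (noIsolated , λ E E∈𝓗 → ¬NoIsolated⇒∃Isolated (remove 𝓗 E) (λ noIsolated∖E →
                                  ¬removable (E , E∈𝓗 , noIsolated∖E)))
    , ⊆ᶠ-refl 𝓗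

economical-⊆ᶠ : (𝓗 : Fam k) → NoIsolated 𝓗 → Σ (Fam k) λ 𝒢 → Economical 𝒢 × 𝒢 ⊆ᶠ 𝓗
economical-⊆ᶠ 𝓗 = economical-⊆ᶠ-bounded (suc (size 𝓗)) 𝓗 ≤-refl

ContainsPartition-mono : {𝒢 𝓗 : Fam k} → 𝒢 ⊆ᶠ 𝓗 → ∀ m → ContainsPartition 𝒢 m → ContainsPartition 𝓗 m
ContainsPartition-mono 𝒢⊆𝓗 m (D , 𝒫 , ∣D∣≡m , 𝒫⊆𝒢 , exactlyOne) =
  D , 𝒫 , ∣D∣≡m , ⊆ᶠ-trans 𝒫⊆𝒢 𝒢⊆𝓗 , exactlyOne

NoPartitionAbove-antimono : ∀ {n} {𝒢 𝓗 : Fam k} → 𝒢 ⊆ᶠ 𝓗 → NoPartitionAbove n 𝓗 → NoPartitionAbove n 𝒢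
NoPartitionAbove-antimono 𝒢⊆𝓗 none m n<m = none m n<m ∘ ContainsPartition-mono 𝒢⊆𝓗 m

HAdmissible⇒EconAdmissible : ∀ n k → HAdmissible n k → EconAdmissible n k
HAdmissible⇒EconAdmissible n k (𝓗 , noIsolated , noPartition) =
  let 𝒢 , economical , 𝒢⊆𝓗 = economical-⊆ᶠ 𝓗 noIsolated
  in 𝒢 , economical , NoPartitionAbove-antimono 𝒢⊆𝓗 noPartition

EconAdmissible⇒HAdmissible : ∀ n k → EconAdmissible n k → HAdmissible n k
EconAdmissible⇒HAdmissible n k (𝓗 , economical , noPartition) = 𝓗 , proj₁ economical , noPartition

IsGreatest-cong : {P Q : ℕ → Set} → (∀ j → P j → Q j) → (∀ j → Q j → P j) →
                  ∀ k → IsGreatest P k → IsGreatest Q k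
IsGreatest-cong P⇒Q Q⇒P k (Pk , greatest) = P⇒Q k Pk , λ j Qj → greatest j (Q⇒P j Qj)

mainTheorem6 : ∀ (n k : ℕ) →
    (IsH n k → IsGreatest (EconAdmissible n) k)
    × (IsGreatest (EconAdmissible n) k → IsH n k)
mainTheorem6 n k =
  IsGreatest-cong (HAdmissible⇒EconAdmissible n) (EconAdmissible⇒HAdmissible n) k ,
  IsGreatest-cong (EconAdmissible⇒HAdmissible n) (HAdmissible⇒EconAdmissible n) k
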